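{- For $n\ge4$, the posets $\mathcal{FL}yn_n^w$ and $\mathcal{FL}yn_n^\bullet$ are not isomorphic. Consequently, $\Pi_n^w$ and $\Pi_n^\bullet$ each have multiple non-isomorphic Whitney duals.
   Context: Trees: a bicolored binary forest on $[n]$ is a forest of rooted planar binary trees (left child $L(v)$, right child $R(v)$) with leaves bijectively labeled by $[n]$ and internal vertices colored in $\{0,1\}$. $\nu(v)$ is the smallest leaf label below $v$; normalized means $\nu(v)=\nu(L(v))$ for all internal $v$; $v$ is Lyndon if $L(v)$ is a leaf or $\nu(R(L(v)))>\nu(R(v))$. A normalized tree is a pointed Lyndon tree if every internal $v$ with internal left child satisfies $\mathrm{color}(L(v))\ge\mathrm{color}(v)$ and, when both colors are $1$, $v$ is Lyndon; it is a bicolored Lyndon tree if every internal $v$ with internal left child is Lyndon or satisfies $\mathrm{color}(L(v))>\mathrm{color}(v)$. To $u$-merge two such trees $T_1,T_2$ (min leaf of $T_1$ smaller), create a new vertex $r$ of color $u$ with left child the root of $T_1$ and right child the root of $T_2$; while the result is not a tree of the required type, replace the subtree $r(x(X_L,X_R),Y)$ by $x(r(X_L,Y),X_R)$, colors kept. $\mathcal{FL}yn_n^\bullet$ (resp. $\mathcal{FL}yn_n^w$) is the set of forests on $[n]$ all of whose components are pointed (resp. bicolored) Lyndon trees, with $F\lessdot F'$ iff $F'$ arises from $F$ by $u$-merging exactly two trees, $u\in\{0,1\}$. $\Pi_n^\bullet$: pointed partitions of $[n]$ (collections of pointed sets $A^p$, $p\in A$, whose underlying sets partition $[n]$), with covers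 replacing two blocks $A^p,B^q$ by $(A\cup B)^p$ or $(A\cup B)^q$. $\Pi_n^w$: weighted partitions of $[n]$ (collections of $A^v$, $v\in\{0,\dots,|A|-1\}$, whose underlying sets partition $[n]$), with covers replacing $A^a,B^b$ by $(A\cup B)^{a+b+u}$, $u\in\{0,1\}$. Graded posets $P,Q$ with minima are Whitney duals if $|w_k(P)|=W_k(Q)$ and $|w_k(Q)|=W_k(P)$ for all $k$, where $w_k(P)=\sum_{\rho(x)=k}\mu(\hat0,x)$ and $W_k(P)=\#\{x:\rho(x)=k\}$. (The posets $\mathcal{FL}yn_n^\bullet$ and $\mathcal{FL}yn_n^w$ are Whitney duals of $\Pi_n^\bullet$; also $\Pi_n^\bullet$ and $\Pi_n^w$ have the same Whitney numbers of both kinds.) -}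

module Defs where

open import Data.Nat using (ℕ; suc; _⊓_; _<_; _≡ᵇ_; _<ᵇ_; _≤ᵇ_)
open import Data.Fin using (Fin; toℕ)
open import Data.Bool using (Bool; true; false; _∧_; _∨_; if_then_else_; T)
open import Data.List using (List; []; _∷_; _++_; concatMap; map; upTo)
open import Data.List.Relation.Unary.All using (All)
open import Data.List.Relation.Binary.Permutation.Propositional using (_↭_)
open import Data.Product using (Σ; _×_; _,_; proj₁; ∃-syntax)
open import Level using (0ℓ)

Colour : Set
Colour = Fin 2

data Tree : Set where
  leaf : ℕ → Tree
  node : Colour → Tree → Tree → Tree

ν : Tree → ℕ
ν (leaf i)     = i
ν (node _ l r) = ν l ⊓ ν r

leaves : Tree → List ℕ
leaves (leaf i)     = i ∷ []
leaves (node _ l r) = leaves l ++ leaves r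

normalized : Tree → Bool
normalized (leaf _)       = true
normalized t@(node _ l r) = (ν t ≡ᵇ ν l) ∧ normalized l ∧ normalized r

lyndonAt : Tree → Bool
lyndonAt (leaf _)                   = true
lyndonAt (node _ (leaf _) _)        = true
lyndonAt (node _ (node _ _ lr) r)   = ν r <ᵇ ν lr

isOne : Colour → Bool
isOne c = toℕ c ≡ᵇ 1

pointedAt : Tree → Bool
pointedAt (leaf _)                 = true
pointedAt (node c (leaf _) _)      = true
pointedAt v@(node c (node c' _ _) _) =
  (toℕ c ≤ᵇ toℕ c') ∧ (if isOne c ∧ isOne c' then lyndonAt v else true)

bicoloredAt : Tree → Bool
bicoloredAt (leaf _)                 = true
bicoloredAt (node c (leaf _) _)      = true
bicoloredAt v@(node c (node c' _ _) _) = lyndonAt v ∨ (toℕ c <ᵇ toℕ c')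

everywhere : (Tree → Bool) → Tree → Bool
everywhere p t@(leaf _)     = p t
everywhere p t@(node _ l r) = p t ∧ everywhere p l ∧ everywhere p r

isPointedLyndon : Tree → Bool
isPointedLyndon t = normalized t ∧ everywhere pointedAt t

isBicoloredLyndon : Tree → Bool
isBicoloredLyndon t = normalized t ∧ everywhere bicoloredAt t

-- The vertex r (colour u, right subtree Y) is pushed down
-- the left spine of T₁ by the rotation r(x(X_L,X_R),Y) ↦ x(r(X_L,Y),X_R)
-- while the tree is not of the required type P.  The context records
-- the vertices x (with their right subtrees X_R) already above r,
-- innermost first.

plug : List (Colour × Tree) → Tree → Tree
plug []              t = t
plug ((c , B) ∷ ctx) t = plug ctx (node c t B)

sift : (Tree → Bool) → Colour → Tree → List (Colour × Tree) → Tree → Tree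
sift P u Y ctx X with P (plug ctx (node u X Y))
... | true  = plug ctx (node u X Y)
sift P u Y ctx (leaf i)       | false = plug ctx (node u (leaf i) Y)
sift P u Y ctx (node c XL XR) | false = sift P u Y ((c , XR) ∷ ctx) XL

-- u-merge T₁ T₂ (assumes ν T₁ < ν T₂)
merge : (Tree → Bool) → Colour → Tree → Tree → Tree
merge P u T₁ T₂ = sift P u T₂ [] T₁

-- Forests on [n] = {1,…,n} all of whose components are of type P.
-- A forest is a set of trees; we represent it by a list, taken up to
-- permutation (_≈F_ below is the equality of forests).

leavesF : List Tree → List ℕ
leavesF = concatMap leaves

FLyn : (Tree → Bool) → ℕ → Set
FLyn P n = Σ (List Tree) λ F → All (λ t → T (P t)) F × (leavesF F ↭ map suc (upTo n))

FLynPointed : ℕ → Set        -- 𝓕𝓛yn_n^•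
FLynPointed = FLyn isPointedLyndon

FLynBicolored : ℕ → Set      -- 𝓕𝓛yn_n^w
FLynBicolored = FLyn isBicoloredLyndon

_≈F_ : ∀ {P n} → FLyn P n → FLyn P n → Set
x ≈F y = proj₁ x ↭ proj₁ y

Cover : ∀ P {n} → FLyn P n → FLyn P n → Set
Cover P x y = ∃[ T₁ ] ∃[ T₂ ] ∃[ rest ] ∃[ u ]
  (proj₁ x ↭ (T₁ ∷ T₂ ∷ rest)) × (ν T₁ < ν T₂) ×
  (proj₁ y ↭ (merge P u T₁ T₂ ∷ rest))

data Le (P : Tree → Bool) {n : ℕ} : FLyn P n → FLyn P n → Set where
  le-refl : ∀ {x y} → x ≈F y → Le P x y
  le-step : ∀ {x z y} → Cover P x z → Le P z y → Le P x y

record OrderIso (P Q : Tree → Bool) (n : ℕ) : Set where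
  field
    to      : FLyn P n → FLyn Q n
    from    : FLyn Q n → FLyn P n
    to-cong   : ∀ {x y} → x ≈F y → to x ≈F to y
    from-cong : ∀ {x y} → x ≈F y → from x ≈F from y
    from∘to : ∀ x → from (to x) ≈F x
    to∘from : ∀ y → to (from y) ≈F y
    to-mono   : ∀ {x y} → Le P x y → Le Q (to x) (to y)
    from-mono : ∀ {x y} → Le Q x y → Le P (from x) (from y)

{-# OPTIONS --safe #-}
-- Merging lowers the number of trees by one, so the covers of both orders are exactly the
-- merges and an order isomorphism carries a fork to a fork: an x covering two distinct
-- y₁, y₂, each of which covers only one element z, which covers a minimal element.
-- Writing c(L,R) for a vertex of colour c and leaving out the singletons 5,…,n, 𝓕𝓛yn^w has
-- the fork x = 1(1(0(1,4),3),2), yₖ = 1(0(1,4),k) ∪ {5-k} (k = 2,3), z = 0(1,4) ∪ {2,3}.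
-- 𝓕𝓛yn^• has none: its minimal elements are the forests of leaves, so y consists of a
-- three-leaf tree M and leaves, and its unique lower cover forces M to be a right comb
-- c(a,c′(b,d)) or the left comb 0(0(a,p),q). For such M, every forest covering y still
-- determines M, hence y₁ = y₂.
module Submission where

open import Defs
open import Data.Nat using (ℕ; _≤_)
open import Relation.Nullary using (¬_)

open import Data.Nat using (suc; _+_; _<_; _⊓_; _≡ᵇ_; _<ᵇ_; s≤s; z≤n)
import Data.Nat.Properties as ℕ
open import Data.Bool using (Bool; true; false; _∧_; T)
open import Data.Bool.Properties using (T-∧; T-≡; ∧-zeroʳ)
open import Data.Empty using (⊥; ⊥-elim)
open import Data.Fin as Fin using ()
open import Data.List using (List; []; _∷_; _++_; map; length; upTo; applyUpTo)
open import Data.List.Properties using (++-assoc; concatMap-++)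
open import Data.List.Membership.Propositional using (_∈_)
open import Data.List.Membership.Propositional.Properties using (∈-∃++; ∈-++⁺ˡ; ∈-++⁺ʳ)
open import Data.List.Relation.Binary.Permutation.Propositional as ↭
  using (_↭_; prep; swap; ↭-refl; ↭-sym; ↭-trans; ↭⇒↭ₛ)
open import Data.List.Relation.Binary.Permutation.Propositional.Properties
  using (∈-resp-↭; All-resp-↭; ↭-length; ++⁺ˡ; ++⁺ʳ; shift; shifts; drop-∷; map⁺)
import Data.List.Relation.Binary.Permutation.Setoid.Properties as ↭ₛ
open import Data.List.Relation.Unary.All as All using (All; []; _∷_)
import Data.List.Relation.Unary.All.Properties as Allₚ
open import Data.List.Relation.Unary.Any using (here; there)
open import Data.List.Relation.Unary.AllPairs using ([]; _∷_)
open import Data.List.Relation.Unary.Unique.Propositional using (Unique)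
import Data.List.Relation.Unary.Unique.Propositional.Properties as Unique
open import Data.Product using (∃₂; _×_; _,_; proj₁; proj₂; ∃-syntax)
open import Data.Sum using (_⊎_; inj₁; inj₂)
open import Function using (_∘_)
open import Function.Bundles using (Equivalence)
open import Relation.Binary.PropositionalEquality
  using (_≡_; _≢_; refl; sym; trans; cong; subst; subst₂; setoid; module ≡-Reasoning)

pattern c₀ = Fin.zero
pattern c₁ = Fin.suc Fin.zero

T-∧⁻ : ∀ x {y} → T (x ∧ y) → T x × T y
T-∧⁻ x = Equivalence.to (T-∧ {x})

T-∧⁺ : ∀ {x y} → T x × T y → T (x ∧ y)
T-∧⁺ = Equivalence.from T-∧

module _ {A : Set} where

  ∈⇒↭∷ : ∀ {x : A} {xs} → x ∈ xs → ∃[ ys ] xs ↭ x ∷ ys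
  ∈⇒↭∷ {x} x∈xs with ∈-∃++ x∈xs
  ... | ys , zs , refl = ys ++ zs , shift x ys zs

  ↭∷⇒∈ : ∀ {x : A} {xs ys} → xs ↭ x ∷ ys → x ∈ xs
  ↭∷⇒∈ p = ∈-resp-↭ (↭-sym p) (here refl)

  ++-cancelˡ-↭ : ∀ xs {ys zs : List A} → xs ++ ys ↭ xs ++ zs → ys ↭ zs
  ++-cancelˡ-↭ []       p = p
  ++-cancelˡ-↭ (x ∷ xs) p = ++-cancelˡ-↭ xs (drop-∷ p)

  Unique-++⇒≢ : ∀ xs {ys} {x y : A} → Unique (xs ++ ys) → x ∈ xs → y ∈ ys → x ≢ y
  Unique-++⇒≢ (_ ∷ xs) (x∉ ∷ _) (here refl) y∈ys = All.lookup x∉ (∈-++⁺ʳ xs y∈ys)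
  Unique-++⇒≢ (_ ∷ xs) (_ ∷ u)  (there x∈)  y∈ys = Unique-++⇒≢ xs u x∈ y∈ys

data IsLeaf : Tree → Set where
  isLeaf : ∀ i → IsLeaf (leaf i)

data IsNode : Tree → Set where
  isNode : ∀ c l r → IsNode (node c l r)

IsLeaf⇒¬IsNode : ∀ {t} → IsLeaf t → ¬ IsNode t
IsLeaf⇒¬IsNode (isLeaf i) ()

ν∈leaves : ∀ t → ν t ∈ leaves t
ν∈leaves (leaf i) = here refl
ν∈leaves (node c l r) with ℕ.⊓-sel (ν l) (ν r)
... | inj₁ e rewrite e = ∈-++⁺ˡ (ν∈leaves l)
... | inj₂ e rewrite e = ∈-++⁺ʳ (leaves l) (ν∈leaves r)

leftDepth : Tree → ℕ
leftDepth (leaf _)     = 0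
leftDepth (node _ l _) = suc (leftDepth l)

leftDepth-plug : ∀ ctx t → leftDepth t ≤ leftDepth (plug ctx t)
leftDepth-plug []              t = ℕ.≤-refl
leftDepth-plug ((c , B) ∷ ctx) t = ℕ.≤-trans (ℕ.n≤1+n _) (leftDepth-plug ctx (node c t B))

plug-isNode : ∀ ctx c l r → IsNode (plug ctx (node c l r))
plug-isNode []               c l r = isNode c l r
plug-isNode ((c′ , B) ∷ ctx) c l r = plug-isNode ctx c′ (node c l r) B

module _ (P : Tree → Bool) (u : Colour) (Y : Tree) where

  sift-view : ∀ ctx X → ∃₂ λ ctx′ X′ →
    plug ctx X ≡ plug ctx′ X′ × sift P u Y ctx X ≡ plug ctx′ (node u X′ Y)
  sift-view ctx X with P (plug ctx (node u X Y))
  ... | true = ctx , X , refl , refl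
  sift-view ctx (leaf i)       | false = ctx , leaf i , refl , refl
  sift-view ctx (node c XL XR) | false = sift-view ((c , XR) ∷ ctx) XL

  sift-stop : ∀ ctx X → P (plug ctx (node u X Y)) ≡ true →
    sift P u Y ctx X ≡ plug ctx (node u X Y)
  sift-stop ctx X eq with P (plug ctx (node u X Y))
  sift-stop ctx X refl | true = refl

  sift-step : ∀ ctx c XL XR → P (plug ctx (node u (node c XL XR) Y)) ≡ false →
    sift P u Y ctx (node c XL XR) ≡ sift P u Y ((c , XR) ∷ ctx) XL
  sift-step ctx c XL XR eq with P (plug ctx (node u (node c XL XR) Y))
  sift-step ctx c XL XR refl | false = refl

  sift-leaf : ∀ ctx i → sift P u Y ctx (leaf i) ≡ plug ctx (node u (leaf i) Y)
  sift-leaf ctx i with P (plug ctx (node u (leaf i) Y))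
  ... | true  = refl
  ... | false = refl

module _ (P : Tree → Bool) (u : Colour) where

  merge-view : ∀ A B → ∃₂ λ ctx X → A ≡ plug ctx X × merge P u A B ≡ plug ctx (node u X B)
  merge-view A B = sift-view P u B [] A

  merge-isNode : ∀ A B → IsNode (merge P u A B)
  merge-isNode A B with merge-view A B
  ... | ctx , X , _ , eq rewrite eq = plug-isNode ctx u X B

  merge-leafˡ : ∀ i B → merge P u (leaf i) B ≡ node u (leaf i) B
  merge-leafˡ i B = sift-leaf P u B [] i

  merge-stop : ∀ A B → T (P (node u A B)) → merge P u A B ≡ node u A B
  merge-stop A B h = sift-stop P u B [] A (Equivalence.to T-≡ h)

  merge-rotate : ∀ c a X B → P (node u (node c (leaf a) X) B) ≡ false →
    merge P u (node c (leaf a) X) B ≡ node c (node u (leaf a) B) X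
  merge-rotate c a X B eq =
    trans (sift-step P u B [] c (leaf a) X eq) (sift-leaf P u B ((c , X) ∷ []) a)

  merge-stop-or-rotate : ∀ c a X B →
    merge P u (node c (leaf a) X) B ≡ node u (node c (leaf a) X) B ⊎
    merge P u (node c (leaf a) X) B ≡ node c (node u (leaf a) B) X
  merge-stop-or-rotate c a X B with P (node u (node c (leaf a) X) B)
  ... | true  = inj₁ refl
  ... | false = inj₂ (sift-leaf P u B ((c , X) ∷ []) a)

  merge-cherry-leaf : ∀ c a b k → ∃[ d ] ∃[ d′ ] ∃[ p ] ∃[ q ]
    merge P u (node c (leaf a) (leaf b)) (leaf k) ≡ node d (node d′ (leaf a) (leaf p)) (leaf q)
  merge-cherry-leaf c a b k with merge-stop-or-rotate c a (leaf b) (leaf k)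
  ... | inj₁ e = u , c , b , k , e
  ... | inj₂ e = c , u , k , b , e

  -- The new vertex ends up on the left spine below the rotated vertices, so a result of
  -- left depth 2 leaves room for at most one rotation.
  merge-onto-leftComb : ∀ A B c c′ a b C → merge P u A B ≡ node c (node c′ (leaf a) (leaf b)) C →
    (A ≡ node c′ (leaf a) (leaf b) × B ≡ C) ⊎ (A ≡ node c (leaf a) C × u ≡ c′ × B ≡ leaf b)
  merge-onto-leftComb A B c c′ a b C eq with merge-view A B
  ... | [] , X , refl , merged with trans (sym merged) eq
  ...   | refl = inj₁ (refl , refl)
  merge-onto-leftComb A B c c′ a b C eq | (_ , _) ∷ [] , X , refl , merged
    with trans (sym merged) eq
  ...   | refl = inj₂ (refl , refl , refl)
  merge-onto-leftComb A B c c′ a b C eq | (d₁ , B₁) ∷ (d₂ , B₂) ∷ ctx , X , refl , merged =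
    ⊥-elim (ℕ.<-irrefl refl (subst (3 ≤_) (cong leftDepth (trans (sym merged) eq))
      (ℕ.≤-trans (s≤s (s≤s (s≤s z≤n)))
                 (leftDepth-plug ctx (node d₂ (node d₁ (node u X B) B₁) B₂)))))

-- isPointedLyndon and isBicoloredLyndon are definitionally Local pointedAt and Local bicoloredAt.
Local : (Tree → Bool) → Tree → Bool
Local p t = normalized t ∧ everywhere p t

Local-node⁻ : ∀ p c l r → T (Local p (node c l r)) → ν l ⊓ ν r ≡ ν l × T (Local p l) × T (Local p r)
Local-node⁻ p c l r h =
  let norm , every = T-∧⁻ (normalized (node c l r)) h
      root , norms = T-∧⁻ (ν l ⊓ ν r ≡ᵇ ν l) norm
      nl , nr      = T-∧⁻ (normalized l) norms
      _ , everys   = T-∧⁻ (p (node c l r)) every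
      el , er      = T-∧⁻ (everywhere p l) everys
  in ℕ.≡ᵇ⇒≡ _ _ root , T-∧⁺ (nl , el) , T-∧⁺ (nr , er)

Local-node⁺ : ∀ p c l r → T (p (node c l r)) → T (Local p l) → T (Local p r) → ν l ≤ ν r →
  T (Local p (node c l r))
Local-node⁺ p c l r pc Ll Lr l≤r =
  let nl , el = T-∧⁻ (normalized l) Ll
      nr , er = T-∧⁻ (normalized r) Lr
      root    = ℕ.≡⇒≡ᵇ _ _ (ℕ.m≤n⇒m⊓n≡m l≤r)
  in T-∧⁺ (T-∧⁺ (root , T-∧⁺ (nl , nr)) , T-∧⁺ (pc , T-∧⁺ (el , er)))

Local-everywhere : ∀ p t → T (Local p t) → T (everywhere p t)
Local-everywhere p t = proj₂ ∘ T-∧⁻ (normalized t)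

Sole : Tree → List Tree → Set
Sole M F = ∃[ R ] F ↭ M ∷ R × All IsLeaf R

Beside : Tree → List Tree → Set
Beside M F = ∃[ u ] ∃[ i ] ∃[ j ] ∃[ R ] F ↭ node u (leaf i) (leaf j) ∷ M ∷ R × All IsLeaf R

sole-node : ∀ {M F t} → Sole M F → t ∈ F → IsNode t → t ≡ M
sole-node (R , F↭ , R-leaves) t∈F t-node with ∈-resp-↭ F↭ t∈F
... | here t≡M  = t≡M
... | there t∈R = ⊥-elim (IsLeaf⇒¬IsNode (All.lookup R-leaves t∈R) t-node)

map-leaf-leavesF : ∀ {R} → All IsLeaf R → map leaf (leavesF R) ≡ R
map-leaf-leavesF []              = refl
map-leaf-leavesF (isLeaf i ∷ lR) = cong (leaf i ∷_) (map-leaf-leavesF lR)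

leavesF-map-leaf : ∀ L → leavesF (map leaf L) ≡ L
leavesF-map-leaf []      = refl
leavesF-map-leaf (i ∷ L) = cong (i ∷_) (leavesF-map-leaf L)

leavesF-↭ : ∀ {F G} → F ↭ G → leavesF F ↭ leavesF G
leavesF-↭ ↭.refl        = ↭-refl
leavesF-↭ (prep t p)    = ++⁺ˡ (leaves t) (leavesF-↭ p)
leavesF-↭ (swap s t p)  =
  ↭-trans (shifts (leaves s) (leaves t)) (++⁺ˡ (leaves t) (++⁺ˡ (leaves s) (leavesF-↭ p)))
leavesF-↭ (↭.trans p q) = ↭-trans (leavesF-↭ p) (leavesF-↭ q)

data Position (M : Tree) : Tree → Tree → List Tree → Set where
  first  : ∀ {B R} → All IsLeaf (B ∷ R) → Position M M B R
  second : ∀ {A R} → All IsLeaf (A ∷ R) → Position M A M R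
  later  : ∀ {A B R R′} → R ↭ M ∷ R′ → All IsLeaf (A ∷ B ∷ R′) → Position M A B R

locate : ∀ {M S A B R} → M ∷ S ↭ A ∷ B ∷ R → All IsLeaf S → Position M A B R
locate {M} {S} {A} {B} {R} MS↭ABR S-leaves with ∈-resp-↭ MS↭ABR (here refl)
... | here refl         = first (All-resp-↭ (drop-∷ MS↭ABR) S-leaves)
... | there (here refl) = second (All-resp-↭ (drop-∷ (↭-trans MS↭ABR (swap A M ↭-refl))) S-leaves)
... | there (there M∈R) with ∈⇒↭∷ M∈R
...   | R′ , R↭MR′ = later R↭MR′ (All-resp-↭ (drop-∷ MS↭MABR′) S-leaves)
  where
  MS↭MABR′ : M ∷ S ↭ M ∷ A ∷ B ∷ R′
  MS↭MABR′ = ↭-trans MS↭ABR (↭-trans (prep A (prep B R↭MR′)) (shift M (A ∷ B ∷ []) R′))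

data Growth (P : Tree → Bool) (M : Tree) (F : List Tree) : Set where
  mergedRight : ∀ u k → ν M < k → Sole (merge P u M (leaf k)) F → Growth P M F
  mergedLeft  : ∀ u k → Sole (node u (leaf k) M) F → Growth P M F
  beside      : Beside M F → Growth P M F

module _ {P : Tree → Bool} {n : ℕ} where

  component-P : (F : FLyn P n) → ∀ {t R} → proj₁ F ↭ t ∷ R → T (P t)
  component-P F F↭ = All.head (All-resp-↭ F↭ (proj₁ (proj₂ F)))

  labels-unique : (F : FLyn P n) → Unique (leavesF (proj₁ F))
  labels-unique F =
    ↭ₛ.Unique-resp-↭ (setoid ℕ) (↭⇒↭ₛ (↭-sym (proj₂ (proj₂ F))))
      (Unique.map⁺ ℕ.suc-injective (Unique.upTo⁺ n))

  labels-unique-at : (F : FLyn P n) → ∀ {t R} → proj₁ F ↭ t ∷ R → Unique (leaves t ++ leavesF R)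
  labels-unique-at F F↭ = ↭ₛ.Unique-resp-↭ (setoid ℕ) (↭⇒↭ₛ (leavesF-↭ F↭)) (labels-unique F)

  no-repeated-component : (F : FLyn P n) → ∀ {t R} → ¬ (proj₁ F ↭ t ∷ t ∷ R)
  no-repeated-component F {t} F↭ =
    Unique-++⇒≢ (leaves t) (labels-unique-at F F↭) (ν∈leaves t) (∈-++⁺ˡ (ν∈leaves t)) refl

  sole-≈ : (F G : FLyn P n) → ∀ {M} → Sole M (proj₁ F) → Sole M (proj₁ G) → F ≈F G
  sole-≈ F G {M} (R , F↭ , R-leaves) (S , G↭ , S-leaves) =
    ↭-trans F↭ (↭-trans (prep M R↭S) (↭-sym G↭))
    where
    leavesᴿ↭leavesˢ : leavesF R ↭ leavesF S
    leavesᴿ↭leavesˢ = ++-cancelˡ-↭ (leaves M) (↭-trans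
      (↭-trans (leavesF-↭ (↭-sym F↭)) (proj₂ (proj₂ F)))
      (↭-sym (↭-trans (leavesF-↭ (↭-sym G↭)) (proj₂ (proj₂ G)))))
    R↭S : R ↭ S
    R↭S = subst₂ _↭_ (map-leaf-leavesF R-leaves) (map-leaf-leavesF S-leaves)
                     (map⁺ leaf leavesᴿ↭leavesˢ)

  leaves-minimal : ∀ {v w : FLyn P n} → All IsLeaf (proj₁ w) → ¬ Cover P v w
  leaves-minimal w-leaves (A , B , _ , u , _ , _ , w↭) =
    IsLeaf⇒¬IsNode (All.head (All-resp-↭ w↭ w-leaves)) (merge-isNode P u A B)

  cover-of-leaves : ∀ {w z : FLyn P n} → Cover P w z → All IsLeaf (proj₁ w) →
    ∃[ u ] ∃[ a ] ∃[ b ] Sole (node u (leaf a) (leaf b)) (proj₁ z)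
  cover-of-leaves {z = z} (A , B , R , u , w↭ , _ , z↭) w-leaves with All-resp-↭ w↭ w-leaves
  ... | isLeaf a ∷ isLeaf b ∷ R-leaves =
    u , a , b , R , subst (λ t → proj₁ z ↭ t ∷ R) (merge-leafˡ P u a (leaf b)) z↭ , R-leaves

  cover-of-sole : ∀ {y x : FLyn P n} {M} → Cover P y x → Sole M (proj₁ y) → Growth P M (proj₁ x)
  cover-of-sole {x = x} (A , B , R , u , y↭ , A<B , x↭) (S , y↭MS , S-leaves)
    with locate (↭-trans (↭-sym y↭MS) y↭) S-leaves
  ... | first (isLeaf k ∷ R-leaves) = mergedRight u k A<B (R , x↭ , R-leaves)
  ... | second (isLeaf k ∷ R-leaves) =
    mergedLeft u k (R , subst (λ t → proj₁ x ↭ t ∷ R) (merge-leafˡ P u k B) x↭ , R-leaves)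
  ... | later {R′ = R′} R↭MR′ (isLeaf i ∷ isLeaf j ∷ R′-leaves) =
    beside (u , i , j , R′ , ↭-trans x↭cherry (prep _ R↭MR′) , R′-leaves)
    where
    x↭cherry = subst (λ t → proj₁ x ↭ t ∷ R) (merge-leafˡ P u i (leaf j)) x↭

module _ {p : Tree → Bool} {n : ℕ} where

  split : (F : FLyn (Local p) n) → ∀ {c l r R} → proj₁ F ↭ node c l r ∷ R →
    ∃[ v ] proj₁ v ≡ l ∷ r ∷ R × Cover (Local p) v F
  split F {c} {l} {r} {R} F↭ = v , refl , (l , r , R , c , ↭-refl , l<r , F↭merged)
    where
    Lt = component-P F F↭
    children = Local-node⁻ p c l r Lt
    leaves-v : leavesF (l ∷ r ∷ R) ↭ map suc (upTo n)
    leaves-v = subst (_↭ map suc (upTo n)) (++-assoc (leaves l) (leaves r) (leavesF R))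
                     (↭-trans (leavesF-↭ (↭-sym F↭)) (proj₂ (proj₂ F)))
    v : FLyn (Local p) n
    v = l ∷ r ∷ R ,
        proj₁ (proj₂ children) ∷ proj₂ (proj₂ children) ∷
          All.tail (All-resp-↭ F↭ (proj₁ (proj₂ F))) ,
        leaves-v
    l<r : ν l < ν r
    l<r = ℕ.≤∧≢⇒< (ℕ.m⊓n≡m⇒m≤n (proj₁ children))
            (Unique-++⇒≢ (leaves l) (labels-unique v) (ν∈leaves l) (∈-++⁺ˡ (ν∈leaves r)))
    F↭merged : proj₁ F ↭ merge (Local p) c l r ∷ R
    F↭merged = subst (λ t → proj₁ F ↭ t ∷ R) (sym (merge-stop (Local p) c l r Lt)) F↭

  minimal⇒leaves : (w : FLyn (Local p) n) → (∀ v → ¬ Cover (Local p) v w) → All IsLeaf (proj₁ w)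
  minimal⇒leaves w minimal = All.tabulate leaf-component
    where
    leaf-component : ∀ {t} → t ∈ proj₁ w → IsLeaf t
    leaf-component {leaf i}     _   = isLeaf i
    leaf-component {node c l r} t∈w =
      let R , w↭ = ∈⇒↭∷ t∈w
          v , _ , v⋖w = split w w↭
      in ⊥-elim (minimal v v⋖w)

  no-second-node : (y z : FLyn (Local p) n) → (∀ v → Cover (Local p) v y → v ≈F z) →
    ∀ {D E R} → Sole D (proj₁ z) → proj₁ y ↭ E ∷ D ∷ R → IsNode D → IsNode E → ⊥
  no-second-node y z unique {D} {E} {R} z-sole y↭ (isNode c l r) E-node =
    no-repeated-component y (subst (λ t → proj₁ y ↭ t ∷ D ∷ R) E≡D y↭)
    where
    v = split y (↭-trans y↭ (swap E D ↭-refl))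
    E∈v : E ∈ proj₁ (proj₁ v)
    E∈v = subst (E ∈_) (sym (proj₁ (proj₂ v))) (there (there (here refl)))
    E≡D : E ≡ D
    E≡D = sole-node z-sole (∈-resp-↭ (unique (proj₁ v) (proj₂ (proj₂ v))) E∈v) E-node

OrderCover : (P : Tree → Bool) {n : ℕ} → FLyn P n → FLyn P n → Set
OrderCover P x y = Le P x y × ¬ x ≈F y × (∀ m → Le P x m → Le P m y → m ≈F x ⊎ m ≈F y)

syntax OrderCover P x y = x ⋖[ P ] y

-- Cover P x y unfolds to a Σ-type that does not determine x and y, hence the explicit {x} {z}.
module _ {P : Tree → Bool} {n : ℕ} where

  private
    size : FLyn P n → ℕ
    size x = length (proj₁ x)

  cover-size : ∀ {x y : FLyn P n} → Cover P x y → suc (size y) ≡ size x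
  cover-size (_ , _ , _ , _ , x↭ , _ , y↭) = trans (cong suc (↭-length y↭)) (sym (↭-length x↭))

  Le-size : ∀ {x y : FLyn P n} → Le P x y → size y ≤ size x
  Le-size (le-refl x≈y) = ℕ.≤-reflexive (sym (↭-length x≈y))
  Le-size {x} (le-step {z = z} c z≤y) =
    ℕ.≤-trans (Le-size z≤y) (ℕ.≤-trans (ℕ.n≤1+n _) (ℕ.≤-reflexive (cover-size {x} {z} c)))

  Le-size-≡ : ∀ {x y : FLyn P n} → Le P x y → size y ≡ size x → x ≈F y
  Le-size-≡ (le-refl x≈y) _ = x≈y
  Le-size-≡ {x} (le-step {z = z} c z≤y) eq =
    ⊥-elim (ℕ.<-irrefl eq (ℕ.≤-trans (s≤s (Le-size z≤y)) (ℕ.≤-reflexive (cover-size {x} {z} c))))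

  Le-respˡ : ∀ {x x′ y : FLyn P n} → x ≈F x′ → Le P x′ y → Le P x y
  Le-respˡ e (le-refl x′≈y) = le-refl (↭-trans e x′≈y)
  Le-respˡ e (le-step (T₁ , T₂ , R , u , x′↭ , lt , z↭) z≤y) =
    le-step (T₁ , T₂ , R , u , ↭-trans e x′↭ , lt , z↭) z≤y

  Le-respʳ : ∀ {x y y′ : FLyn P n} → Le P x y → y ≈F y′ → Le P x y′
  Le-respʳ (le-refl x≈y)   e = le-refl (↭-trans x≈y e)
  Le-respʳ (le-step c z≤y) e = le-step c (Le-respʳ z≤y e)

  Cover-respʳ : ∀ {x y y′ : FLyn P n} → Cover P x y → y ≈F y′ → Cover P x y′
  Cover-respʳ (T₁ , T₂ , R , u , x↭ , lt , y↭) e = T₁ , T₂ , R , u , x↭ , lt , ↭-trans (↭-sym e) y↭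

  Cover⇒Le : ∀ {x y : FLyn P n} → Cover P x y → Le P x y
  Cover⇒Le {x} {y} c = le-step {x = x} {z = y} c (le-refl ↭-refl)

  Cover⇒⋖ : ∀ {x y : FLyn P n} → Cover P x y → x ⋖[ P ] y
  Cover⇒⋖ {x} {y} c = Cover⇒Le c , x≉y , between
    where
    x≉y : ¬ x ≈F y
    x≉y x≈y = ℕ.1+n≢n (trans (cover-size {x} {y} c) (↭-length x≈y))
    between : ∀ m → Le P x m → Le P m y → m ≈F x ⊎ m ≈F y
    between m x≤m m≤y with ℕ.m≤n⇒m<n∨m≡n (Le-size x≤m)
    ... | inj₂ eq = inj₁ (↭-sym (Le-size-≡ x≤m eq))
    ... | inj₁ lt = inj₂ (Le-size-≡ m≤y (ℕ.≤-antisym (Le-size m≤y)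
                            (ℕ.≤-pred (subst (_ <_) (sym (cover-size {x} {y} c)) lt))))

  ⋖⇒Cover : ∀ {x y : FLyn P n} → x ⋖[ P ] y → Cover P x y
  ⋖⇒Cover (le-refl x≈y , x≉y , _) = ⊥-elim (x≉y x≈y)
  ⋖⇒Cover {x} {y} (le-step {z = z} c z≤y , _ , between) with between z (Cover⇒Le {x} {z} c) z≤y
  ... | inj₁ z≈x = ⊥-elim (ℕ.1+n≢n (trans (cover-size {x} {z} c) (sym (↭-length z≈x))))
  ... | inj₂ z≈y = Cover-respʳ {x} {z} {y} c z≈y

OrderIso-sym : ∀ {P Q n} → OrderIso P Q n → OrderIso Q P n
OrderIso-sym I = record
  { to = from ; from = to ; to-cong = from-cong ; from-cong = to-cong
  ; from∘to = to∘from ; to∘from = from∘to ; to-mono = from-mono ; from-mono = to-mono }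
  where open OrderIso I

module _ {P Q : Tree → Bool} {n : ℕ} (I : OrderIso P Q n) where
  open OrderIso I

  to-reflects-≈ : ∀ {x y} → to x ≈F to y → x ≈F y
  to-reflects-≈ {x} {y} e = ↭-trans (↭-sym (from∘to x)) (↭-trans (from-cong e) (from∘to y))

  to-⋖ : ∀ {x y} → x ⋖[ P ] y → to x ⋖[ Q ] to y
  to-⋖ {x} {y} (x≤y , x≉y , between) = to-mono x≤y , x≉y ∘ to-reflects-≈ , between′
    where
    between′ : ∀ m → Le Q (to x) m → Le Q m (to y) → m ≈F to x ⊎ m ≈F to y
    between′ m x≤m m≤y
      with between (from m) (Le-respˡ (↭-sym (from∘to x)) (from-mono x≤m))
                            (Le-respʳ (from-mono m≤y) (from∘to y))
    ... | inj₁ e = inj₁ (↭-trans (↭-sym (to∘from m)) (to-cong e))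
    ... | inj₂ e = inj₂ (↭-trans (↭-sym (to∘from m)) (to-cong e))

  Cover-to : ∀ {x y} → Cover P x y → Cover Q (to x) (to y)
  Cover-to = ⋖⇒Cover ∘ to-⋖ ∘ Cover⇒⋖

-- Forks

record Descent (P : Tree → Bool) {n : ℕ} (x y : FLyn P n) : Set where
  field
    z w              : FLyn P n
    y⋖x              : Cover P y x
    z⋖y              : Cover P z y
    only-lower-cover : ∀ v → Cover P v y → v ≈F z
    w⋖z              : Cover P w z
    w-minimal        : ∀ v → ¬ Cover P v w

record Fork (P : Tree → Bool) (n : ℕ) : Set where
  field
    x y₁ y₂  : FLyn P n
    y₁≉y₂    : ¬ y₁ ≈F y₂
    descent₁ : Descent P x y₁
    descent₂ : Descent P x y₂

module _ {P Q : Tree → Bool} {n : ℕ} (I : OrderIso P Q n) where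
  open OrderIso I

  Cover-from-to : ∀ {v y} → Cover Q v (to y) → Cover P (from v) y
  Cover-from-to {v} {y} c =
    Cover-respʳ {x = from v} {y = from (to y)} {y′ = y}
      (Cover-to (OrderIso-sym I) {v} {to y} c) (from∘to y)

  Descent-to : ∀ {x y} → Descent P x y → Descent Q (to x) (to y)
  Descent-to d = record
    { z = to z ; w = to w
    ; y⋖x = Cover-to I y⋖x ; z⋖y = Cover-to I z⋖y ; w⋖z = Cover-to I w⋖z
    ; only-lower-cover = λ v c →
        ↭-trans (↭-sym (to∘from v)) (to-cong (only-lower-cover (from v) (Cover-from-to c)))
    ; w-minimal = λ v c → w-minimal (from v) (Cover-from-to c) }
    where open Descent d

  Fork-to : Fork P n → Fork Q n
  Fork-to f = record
    { x = to x ; y₁ = to y₁ ; y₂ = to y₂ ; y₁≉y₂ = y₁≉y₂ ∘ to-reflects-≈ I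
    ; descent₁ = Descent-to descent₁ ; descent₂ = Descent-to descent₂ }
    where open Fork f

-- A fork in 𝓕𝓛yn^w

module _ (m : ℕ) where

  private
    N : ℕ
    N = 4 + m

    others : List ℕ
    others = map suc (applyUpTo (4 +_) m)

    singletons : List Tree
    singletons = map leaf others

    singletons-leaves : All IsLeaf singletons
    singletons-leaves = Allₚ.map⁺ (All.universal isLeaf others)

    forest : ∀ ts → All (λ t → T (isBicoloredLyndon t)) ts → leavesF ts ↭ 1 ∷ 2 ∷ 3 ∷ 4 ∷ [] →
      FLynBicolored N
    forest ts ts-bicoloured ts↭ =
      ts ++ singletons ,
      Allₚ.++⁺ ts-bicoloured (Allₚ.map⁺ (All.universal _ others)) ,
      subst (_↭ map suc (upTo N)) (sym leaves-forest) (++⁺ʳ others ts↭)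
      where
      leaves-forest : leavesF (ts ++ singletons) ≡ leavesF ts ++ others
      leaves-forest =
        trans (concatMap-++ leaves ts singletons) (cong (leavesF ts ++_) (leavesF-map-leaf others))

    cherry : Tree
    cherry = node c₀ (leaf 1) (leaf 4)

    comb : ℕ → Tree
    comb k = node c₁ cherry (leaf k)

    1423↭1234 : 1 ∷ 4 ∷ 2 ∷ 3 ∷ [] ↭ 1 ∷ 2 ∷ 3 ∷ 4 ∷ []
    1423↭1234 = prep 1 (↭-trans (swap 4 2 ↭-refl) (prep 2 (swap 4 3 ↭-refl)))

    1432↭1234 : 1 ∷ 4 ∷ 3 ∷ 2 ∷ [] ↭ 1 ∷ 2 ∷ 3 ∷ 4 ∷ []
    1432↭1234 = ↭-trans (prep 1 (prep 4 (swap 3 2 ↭-refl))) 1423↭1234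

    w z y₁ y₂ x : FLynBicolored N
    w  = forest (leaf 1 ∷ leaf 2 ∷ leaf 3 ∷ leaf 4 ∷ []) (_ ∷ _ ∷ _ ∷ _ ∷ []) ↭-refl
    z  = forest (cherry ∷ leaf 2 ∷ leaf 3 ∷ []) (_ ∷ _ ∷ _ ∷ []) 1423↭1234
    y₁ = forest (comb 2 ∷ leaf 3 ∷ []) (_ ∷ _ ∷ []) 1423↭1234
    y₂ = forest (comb 3 ∷ leaf 2 ∷ []) (_ ∷ _ ∷ []) 1432↭1234
    x  = forest (node c₁ (comb 3) (leaf 2) ∷ []) (_ ∷ []) 1432↭1234

    lower-cover-of-comb : ∀ {k k′ u A B R} →
      merge isBicoloredLyndon c₀ (node c₁ (leaf 1) (leaf k)) (leaf 4) ≢ comb k →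
      comb k ∷ leaf k′ ∷ singletons ↭ merge isBicoloredLyndon u A B ∷ R →
      A ∷ B ∷ R ↭ cherry ∷ leaf k ∷ leaf k′ ∷ singletons
    lower-cover-of-comb {k} {k′} {u} {A} {B} {R} rotation≢comb y↭ with ↭∷⇒∈ y↭
    ... | there t∈ = ⊥-elim (IsLeaf⇒¬IsNode (All.lookup (isLeaf k′ ∷ singletons-leaves) t∈)
                                            (merge-isNode isBicoloredLyndon u A B))
    ... | here merged with merge-onto-leftComb isBicoloredLyndon u A B c₁ c₀ 1 4 (leaf k) merged
    ...   | inj₂ (refl , refl , refl) = ⊥-elim (rotation≢comb merged)
    ...   | inj₁ (refl , refl) = prep cherry (prep (leaf k) (↭-sym (drop-∷ y↭comb)))
      where y↭comb = subst (λ t → comb k ∷ leaf k′ ∷ singletons ↭ t ∷ R) merged y↭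

    w⋖z : Cover isBicoloredLyndon w z
    w⋖z = leaf 1 , leaf 4 , leaf 2 ∷ leaf 3 ∷ singletons , c₀ ,
          prep (leaf 1) (↭-trans (prep (leaf 2) (swap (leaf 3) (leaf 4) ↭-refl))
                                 (swap (leaf 2) (leaf 4) ↭-refl)) ,
          s≤s (s≤s z≤n) , ↭-refl

    w-minimal : ∀ v → ¬ Cover isBicoloredLyndon v w
    w-minimal v = leaves-minimal {v = v} {w = w}
                    (isLeaf 1 ∷ isLeaf 2 ∷ isLeaf 3 ∷ isLeaf 4 ∷ singletons-leaves)

    descent₁ : Descent isBicoloredLyndon x y₁
    descent₁ = record
      { z = z ; w = w ; w⋖z = w⋖z ; w-minimal = w-minimal
      ; y⋖x = comb 2 , leaf 3 , singletons , c₁ , ↭-refl , s≤s (s≤s z≤n) , ↭-refl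
      ; z⋖y = cherry , leaf 2 , leaf 3 ∷ singletons , c₁ , ↭-refl , s≤s (s≤s z≤n) , ↭-refl
      ; only-lower-cover = λ { v (_ , _ , _ , _ , v↭ , _ , y↭) →
          ↭-trans v↭ (lower-cover-of-comb (λ ()) y↭) }
      }

    descent₂ : Descent isBicoloredLyndon x y₂
    descent₂ = record
      { z = z ; w = w ; w⋖z = w⋖z ; w-minimal = w-minimal
      ; y⋖x = comb 3 , leaf 2 , singletons , c₁ , ↭-refl , s≤s (s≤s z≤n) , ↭-refl
      ; z⋖y = cherry , leaf 3 , leaf 2 ∷ singletons , c₁ ,
              prep cherry (swap (leaf 2) (leaf 3) ↭-refl) , s≤s (s≤s z≤n) , ↭-refl
      ; only-lower-cover = λ { v (_ , _ , _ , _ , v↭ , _ , y↭) →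
          ↭-trans v↭ (↭-trans (lower-cover-of-comb (λ ()) y↭)
                              (prep cherry (swap (leaf 3) (leaf 2) ↭-refl))) }
      }

    y₁≉y₂ : ¬ y₁ ≈F y₂
    y₁≉y₂ y₁≈y₂ with ∈-resp-↭ y₁≈y₂ (here refl)
    ... | here ()
    ... | there (here ())
    ... | there (there t∈) = IsLeaf⇒¬IsNode (All.lookup singletons-leaves t∈) (isNode _ _ _)

  bicoloured-fork : Fork isBicoloredLyndon (4 + m)
  bicoloured-fork = record
    { x = x ; y₁ = y₁ ; y₂ = y₂ ; y₁≉y₂ = y₁≉y₂ ; descent₁ = descent₁ ; descent₂ = descent₂ }

-- No fork in 𝓕𝓛yn^•

data Comb : Tree → Set where
  right : ∀ c a c′ b d → Comb (node c (leaf a) (node c′ (leaf b) (leaf d)))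
  left₀ : ∀ a p q → Comb (node c₀ (node c₀ (leaf a) (leaf p)) (leaf q))

Comb⇒IsNode : ∀ {M} → Comb M → IsNode M
Comb⇒IsNode (right _ _ _ _ _) = isNode _ _ _
Comb⇒IsNode (left₀ _ _ _)     = isNode _ _ _

¬Comb-cherry : ∀ {u i j} → ¬ Comb (node u (leaf i) (leaf j))
¬Comb-cherry ()

data Grown : Tree → Tree → Set where
  prefix      : ∀ u k M → Grown M (node u (leaf k) M)
  rightOnTop  : ∀ u c a c′ b d k → Grown (node c (leaf a) (node c′ (leaf b) (leaf d)))
                  (node u (node c (leaf a) (node c′ (leaf b) (leaf d))) (leaf k))
  rightInside : ∀ u c a c′ b d k → Grown (node c (leaf a) (node c′ (leaf b) (leaf d)))
                  (node c (node u (leaf a) (leaf k)) (node c′ (leaf b) (leaf d)))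
  leftOnTop   : ∀ a p q k → Grown (node c₀ (node c₀ (leaf a) (leaf p)) (leaf q))
                  (node c₀ (node c₀ (node c₀ (leaf a) (leaf p)) (leaf q)) (leaf k))
  leftInside  : ∀ a p q k → Grown (node c₀ (node c₀ (leaf a) (leaf p)) (leaf q))
                  (node c₀ (node c₀ (node c₁ (leaf a) (leaf k)) (leaf p)) (leaf q))

Grown-injective : ∀ {M₁ M₂ X} → Grown M₁ X → Grown M₂ X → M₁ ≡ M₂
Grown-injective (prefix _ _ _)              (prefix _ _ _)              = refl
Grown-injective (rightOnTop _ _ _ _ _ _ _)  (rightOnTop _ _ _ _ _ _ _)  = refl
Grown-injective (rightInside _ _ _ _ _ _ _) (rightInside _ _ _ _ _ _ _) = refl
Grown-injective (leftOnTop _ _ _ _)         (leftOnTop _ _ _ _)         = refl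
Grown-injective (leftInside _ _ _ _)        (leftInside _ _ _ _)        = refl

Grown⇒IsNode : ∀ {M X} → Grown M X → IsNode X
Grown⇒IsNode (prefix _ _ _)              = isNode _ _ _
Grown⇒IsNode (rightOnTop _ _ _ _ _ _ _)  = isNode _ _ _
Grown⇒IsNode (rightInside _ _ _ _ _ _ _) = isNode _ _ _
Grown⇒IsNode (leftOnTop _ _ _ _)         = isNode _ _ _
Grown⇒IsNode (leftInside _ _ _ _)        = isNode _ _ _

pointed-cherry : ∀ c {a q} → a ≤ q → T (isPointedLyndon (node c (leaf a) (leaf q)))
pointed-cherry c {a} {q} = Local-node⁺ pointedAt c (leaf a) (leaf q) _ _ _

twin-colours : ∀ c c′ a p q →
  T (isPointedLyndon (node c (node c′ (leaf a) (leaf p)) (leaf q))) →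
  T (isPointedLyndon (node c′ (node c (leaf a) (leaf q)) (leaf p))) → c ≡ c₀ × c′ ≡ c₀
twin-colours c₀ c₀ a p q _ _  = refl , refl
twin-colours c₀ c₁ a p q _ h  =
  ⊥-elim (Local-everywhere pointedAt (node c₁ (node c₀ (leaf a) (leaf q)) (leaf p)) h)
twin-colours c₁ c₀ a p q h _  =
  ⊥-elim (Local-everywhere pointedAt (node c₁ (node c₀ (leaf a) (leaf p)) (leaf q)) h)
twin-colours c₁ c₁ a p q h h′ = ⊥-elim (ℕ.<-asym (lyndon p q h) (lyndon q p h′))
  where
  lyndon : ∀ s t → T (isPointedLyndon (node c₁ (node c₁ (leaf a) (leaf s)) (leaf t))) → t < s
  lyndon s t h = ℕ.<ᵇ⇒< t s (proj₁ (T-∧⁻ (t <ᵇ s)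
    (Local-everywhere pointedAt (node c₁ (node c₁ (leaf a) (leaf s)) (leaf t)) h)))

merge-c₁-leftComb₀ : ∀ a p q k →
  merge isPointedLyndon c₁ (node c₀ (node c₀ (leaf a) (leaf p)) (leaf q)) (leaf k)
  ≡ node c₀ (node c₀ (node c₁ (leaf a) (leaf k)) (leaf p)) (leaf q)
merge-c₁-leftComb₀ a p q k =
  begin
    sift Pt c₁ (leaf k) [] (node c₀ (node c₀ (leaf a) (leaf p)) (leaf q))
      ≡⟨ sift-step Pt c₁ (leaf k) [] c₀ (node c₀ (leaf a) (leaf p)) (leaf q) (∧-zeroʳ _) ⟩
    sift Pt c₁ (leaf k) ((c₀ , leaf q) ∷ []) (node c₀ (leaf a) (leaf p))
      ≡⟨ sift-step Pt c₁ (leaf k) ((c₀ , leaf q) ∷ []) c₀ (leaf a) (leaf p) (∧-zeroʳ _) ⟩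
    sift Pt c₁ (leaf k) ((c₀ , leaf p) ∷ (c₀ , leaf q) ∷ []) (leaf a)
      ≡⟨ sift-leaf Pt c₁ (leaf k) ((c₀ , leaf p) ∷ (c₀ , leaf q) ∷ []) a ⟩
    node c₀ (node c₀ (node c₁ (leaf a) (leaf k)) (leaf p)) (leaf q)
  ∎
  where
  open ≡-Reasoning
  Pt = isPointedLyndon

comb-merge : ∀ {M k} → Comb M → T (isPointedLyndon M) → ν M < k →
  ∀ u → Grown M (merge isPointedLyndon u M (leaf k))
comb-merge {k = k} (right c a c′ b d) _ _ u
  with merge-stop-or-rotate isPointedLyndon u c a (node c′ (leaf b) (leaf d)) (leaf k)
... | inj₁ e = subst (Grown _) (sym e) (rightOnTop u c a c′ b d k)
... | inj₂ e = subst (Grown _) (sym e) (rightInside u c a c′ b d k)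
comb-merge {M} {k} (left₀ a p q) M-pointed M<k c₀ =
  subst (Grown M) (sym (merge-stop isPointedLyndon c₀ M (leaf k) on-top-pointed))
        (leftOnTop a p q k)
  where
  on-top-pointed = Local-node⁺ pointedAt c₀ M (leaf k) _ M-pointed _ (ℕ.<⇒≤ M<k)
comb-merge {k = k} (left₀ a p q) _ _ c₁ =
  subst (Grown _) (sym (merge-c₁-leftComb₀ a p q k)) (leftInside a p q k)

Extension : Tree → List Tree → Set
Extension M F = (∃[ X ] Grown M X × Sole X F) ⊎ Beside M F

comb-extension : ∀ {M F} → Comb M → T (isPointedLyndon M) → Growth isPointedLyndon M F →
  Extension M F
comb-extension comb M-pointed (mergedRight u k M<k sole) =
  inj₁ (_ , comb-merge comb M-pointed M<k u , sole)
comb-extension {M} _ _ (mergedLeft u k sole) = inj₁ (_ , prefix u k M , sole)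
comb-extension _ _ (beside b) = inj₂ b

extension-determines : ∀ {M₁ M₂ F} → Comb M₁ → Comb M₂ → Extension M₁ F → Extension M₂ F → M₁ ≡ M₂
extension-determines _ _ (inj₁ (_ , g₁ , s₁)) (inj₁ (_ , g₂ , (_ , F↭ , _))) =
  Grown-injective g₁ (subst (Grown _) (sole-node s₁ (↭∷⇒∈ F↭) (Grown⇒IsNode g₂)) g₂)
extension-determines _ comb₂ (inj₁ (_ , _ , s₁)) (inj₂ (_ , _ , _ , _ , F↭ , _)) =
  ⊥-elim (¬Comb-cherry (subst Comb (trans M₂≡X₁ (sym cherry≡X₁)) comb₂))
  where
  cherry≡X₁ = sole-node s₁ (↭∷⇒∈ F↭) (isNode _ _ _)
  M₂≡X₁ = sole-node s₁ (∈-resp-↭ (↭-sym F↭) (there (here refl))) (Comb⇒IsNode comb₂)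
extension-determines comb₁ comb₂ e₁@(inj₂ _) e₂@(inj₁ _) =
  sym (extension-determines comb₂ comb₁ e₂ e₁)
extension-determines comb₁ _ (inj₂ (_ , _ , _ , _ , F↭₁ , _))
                             (inj₂ (_ , _ , _ , _ , F↭₂ , R-leaves))
  with ∈-resp-↭ F↭₂ (∈-resp-↭ (↭-sym F↭₁) (there (here refl)))
... | here refl          = ⊥-elim (¬Comb-cherry comb₁)
... | there (here M₁≡M₂) = M₁≡M₂
... | there (there M₁∈R) = ⊥-elim (IsLeaf⇒¬IsNode (All.lookup R-leaves M₁∈R) (Comb⇒IsNode comb₁))

module _ {n : ℕ} where

  twin-lower-cover : (y : FLynPointed n) → ∀ {c c′ a p q R} →
    proj₁ y ↭ node c (node c′ (leaf a) (leaf p)) (leaf q) ∷ R →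
    isPointedLyndon (node c′ (node c (leaf a) (leaf q)) (leaf p)) ≡ false →
    ∃[ v ] proj₁ v ≡ node c (leaf a) (leaf q) ∷ leaf p ∷ R × Cover isPointedLyndon v y
  twin-lower-cover y {c} {c′} {a} {p} {q} {R} y↭ twin-rejected =
    v , refl , (node c (leaf a) (leaf q) , leaf p , R , c′ , ↭-refl , a⊓q<p , y↭merged)
    where
    outer = Local-node⁻ pointedAt c (node c′ (leaf a) (leaf p)) (leaf q) (component-P y y↭)
    inner = Local-node⁻ pointedAt c′ (leaf a) (leaf p) (proj₁ (proj₂ outer))
    a≤p : a ≤ p
    a≤p = ℕ.m⊓n≡m⇒m≤n (proj₁ inner)
    a≤q : a ≤ q
    a≤q = ℕ.m⊓n≡m⇒m≤n (trans (cong (_⊓ q) (sym (proj₁ inner))) (trans (proj₁ outer) (proj₁ inner)))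
    a≢p : a ≢ p
    a≢p with labels-unique-at y y↭
    ... | (a≢p ∷ _) ∷ _ = a≢p
    a⊓q<p : a ⊓ q < p
    a⊓q<p = subst (_< p) (sym (ℕ.m≤n⇒m⊓n≡m a≤q)) (ℕ.≤∧≢⇒< a≤p a≢p)
    leaves-v : leavesF (node c (leaf a) (leaf q) ∷ leaf p ∷ R) ↭ map suc (upTo n)
    leaves-v = ↭-trans (prep a (swap q p ↭-refl)) (↭-trans (leavesF-↭ (↭-sym y↭)) (proj₂ (proj₂ y)))
    v : FLynPointed n
    v = _ , pointed-cherry c a≤q ∷ _ ∷ All.tail (All-resp-↭ y↭ (proj₁ (proj₂ y))) , leaves-v
    y↭merged : proj₁ y ↭ merge isPointedLyndon c′ (node c (leaf a) (leaf q)) (leaf p) ∷ R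
    y↭merged = subst (λ t → proj₁ y ↭ t ∷ R)
                     (sym (merge-rotate isPointedLyndon c′ c a (leaf q) (leaf p) twin-rejected)) y↭

  -- A non-pointed twin yields a second lower cover; a pointed twin forces both colours to be 0.
  leftComb⇒Comb : (y z : FLynPointed n) → (∀ v → Cover isPointedLyndon v y → v ≈F z) →
    ∀ {c c′ a p q} → Sole (node c (node c′ (leaf a) (leaf p)) (leaf q)) (proj₁ y) →
    Comb (node c (node c′ (leaf a) (leaf p)) (leaf q))
  leftComb⇒Comb y z unique {c} {c′} {a} {p} {q} (R , y↭ , R-leaves)
    with isPointedLyndon (node c′ (node c (leaf a) (leaf q)) (leaf p)) in twin
  ... | true with twin-colours c c′ a p q (component-P y y↭) (Equivalence.from T-≡ twin)
  ...   | refl , refl = left₀ a p q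
  leftComb⇒Comb y z unique {c} {c′} {a} {p} {q} (R , y↭ , R-leaves) | false = ⊥-elim (p≢q p≡q)
    where
    p≢q : p ≢ q
    p≢q with labels-unique-at y y↭
    ... | _ ∷ (p≢q ∷ _) ∷ _ = p≢q
    v₁ = split {p = pointedAt} y y↭
    v₂ = twin-lower-cover y y↭ twin
    v₁≈v₂ : node c′ (leaf a) (leaf p) ∷ leaf q ∷ R ↭ node c (leaf a) (leaf q) ∷ leaf p ∷ R
    v₁≈v₂ = subst₂ _↭_ (proj₁ (proj₂ v₁)) (proj₁ (proj₂ v₂))
      (↭-trans (unique (proj₁ v₁) (proj₂ (proj₂ v₁)))
               (↭-sym (unique (proj₁ v₂) (proj₂ (proj₂ v₂)))))
    p≡q : p ≡ q
    p≡q with ∈-resp-↭ v₁≈v₂ (here refl)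
    ... | here refl         = refl
    ... | there (here ())
    ... | there (there t∈R) = ⊥-elim (IsLeaf⇒¬IsNode (All.lookup R-leaves t∈R) (isNode _ _ _))

  comb-below : (y z : FLynPointed n) → Cover isPointedLyndon z y →
    (∀ v → Cover isPointedLyndon v y → v ≈F z) →
    ∀ {u a b} → Sole (node u (leaf a) (leaf b)) (proj₁ z) → ∃[ M ] Comb M × Sole M (proj₁ y)
  comb-below y z z⋖y unique {u} {a} {b} z-sole
    with cover-of-sole {P = isPointedLyndon} {y = z} {x = y} z⋖y z-sole
  ... | mergedLeft u′ a′ y-sole = _ , right u′ a′ u a b , y-sole
  ... | beside (_ , _ , _ , _ , y↭ , _) =
    ⊥-elim (no-second-node {p = pointedAt} y z unique z-sole y↭ (isNode _ _ _) (isNode _ _ _))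
  ... | mergedRight u′ k _ y-sole with merge-cherry-leaf isPointedLyndon u′ u a b k
  ...   | _ , _ , _ , _ , e = _ , leftComb⇒Comb y z unique y-sole′ , y-sole′
    where y-sole′ = subst (λ t → Sole t (proj₁ y)) e y-sole

  pointed-descent : ∀ {x y : FLynPointed n} → Descent isPointedLyndon x y →
    ∃[ M ] Comb M × Sole M (proj₁ y) × Extension M (proj₁ x)
  pointed-descent {x} {y} d =
    let _ , _ , _ , z-sole = cover-of-leaves {w = w} {z = z} w⋖z
                               (minimal⇒leaves {p = pointedAt} w w-minimal)
        M , comb , y-sole = comb-below y z z⋖y only-lower-cover z-sole
        M-pointed = component-P y (proj₁ (proj₂ y-sole))
    in M , comb , y-sole , comb-extension comb M-pointed (cover-of-sole {y = y} {x = x} y⋖x y-sole)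
    where open Descent d

  no-pointed-fork : ¬ Fork isPointedLyndon n
  no-pointed-fork f =
    let M₁ , comb₁ , sole₁ , ext₁ = pointed-descent descent₁
        M₂ , comb₂ , sole₂ , ext₂ = pointed-descent descent₂
        M₁≡M₂ = extension-determines comb₁ comb₂ ext₁ ext₂
    in y₁≉y₂ (sole-≈ y₁ y₂ sole₁ (subst (λ M → Sole M (proj₁ y₂)) (sym M₁≡M₂) sole₂))
    where open Fork f

theorem5p4 : ∀ (n : ℕ) → 4 ≤ n → ¬ OrderIso isBicoloredLyndon isPointedLyndon n
theorem5p4 (suc (suc (suc (suc m)))) (s≤s (s≤s (s≤s (s≤s z≤n)))) I =
  no-pointed-fork (Fork-to I (bicoloured-fork m))
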